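{- Let $\mathscr{A}=(\mathscr{A},{\preccurlyeq},{\to},S)$ be an implicative algebra. For each set $I$, write $\mathsf{P}{I}=\mathscr{A}^I/S[I]$. Then: (1) The correspondence $I\mapsto\mathsf{P}{I}$ induces a (contravariant) functor $\mathsf{P}:\mathbf{Set}^{\mathrm{op}}\to\mathbf{HA}$ (where, for $f:I\to J$, the map $\mathsf{P}f:\mathsf{P}J\to\mathsf{P}I$ is induced on the quotients by the reindexing map $a\mapsto a\circ f$ from $\mathscr{A}^J$ to $\mathscr{A}^I$). (2) The functor $\mathsf{P}:\mathbf{Set}^{\mathrm{op}}\to\mathbf{HA}$ is a $\mathbf{Set}$-based tripos.
   Context: An implicative structure $(\mathscr{A},\preccurlyeq,\to)$ is a complete lattice $(\mathscr{A},\preccurlyeq)$ (arbitrary meets written $\bigwedge$, top $\top$, bottom $\bot$) with a binary operation $\to$ that is anti-monotonic in its first argument, monotonic in its second, and satisfies $a\to\bigwedge_{b\in B}b=\bigwedge_{b\in B}(a\to b)$ for all $a\in\mathscr{A}$ and all $B\subseteq\mathscr{A}$. A separator is a subset $S\subseteq\mathscr{A}$ that is upwards closed, contains $\mathbf{K}^{\mathscr{A}}=\bigwedge_{a,b\in\mathscr{A}}(a\to b\to a)$ and $\mathbf{S}^{\mathscr{A}}=\bigwedge_{a,b,c\in\mathscr{A}}((a\to b\to c)\to(a\to b)\to a\to c)$, and is closed under modus ponens (if $(a\to b)\in S$ and $a\in S$ then $b\in S$); an implicative algebra is an implicative structure together with a separator. For a set $I$, $\mathscr{A}^I$ is the product implicative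 structure (order and implication defined componentwise), and the uniform power separator is $S[I]=\{a\in\mathscr{A}^I:\exists s\in S,\ \forall i\in I,\ s\preccurlyeq a_i\}$. For a separator $T$ of an implicative structure $\mathscr{B}$, $\mathscr{B}/T$ denotes the poset reflection of the preorder $b\vdash_T b'$ iff $(b\to b')\in T$; it is a Heyting algebra. A $\mathbf{Set}$-based tripos is a functor $\mathsf{P}:\mathbf{Set}^{\mathrm{op}}\to\mathbf{HA}$ such that (i) for every $f:I\to J$, $\mathsf{P}f$ has a left adjoint $\exists f$ and a right adjoint $\forall f$ in the category of posets; (ii) the Beck–Chevalley condition holds: for every pullback square $g_1\circ f_1=g_2\circ f_2$ in $\mathbf{Set}$ (with $f_1:I\to I_1$, $f_2:I\to I_2$, $g_1:I_1\to J$, $g_2:I_2\to J$), $\exists f_1\circ\mathsf{P}f_2=\mathsf{P}g_1\circ\exists g_2$ and $\forall f_1\circ\mathsf{P}f_2=\mathsf{P}g_1\circ\forall g_2$; (iii) there is a generic predicate $\mathsf{Tr}\in\mathsf{P}\,\mathit{Prop}$ for some set $\mathit{Prop}$ such that for every set $I$ the map $\mathit{Prop}^I\to\mathsf{P}I$, $f\mapsto\mathsf{P}f(\mathsf{Tr})$, is surjective. -}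

module Defs where

open import Level using (Level; _⊔_) renaming (suc to lsuc)
open import Data.Product using (Σ; _×_; _,_; ∃)
open import Function using (_∘_; id)
open import Relation.Binary.PropositionalEquality using (_≡_)
open import Relation.Binary.Structures using (IsPartialOrder)
open import Relation.Binary.Lattice.Structures using (IsHeytingAlgebra)

-- A complete lattice (A , ≼) is given by a partial order (with respect
-- to propositional equality) together with meets ⋀ of arbitrary
-- families indexed by sets of the same universe level (subsets B ⊆ A
-- are the special case of the family Σ A B → A).

record ImplicativeStructure (ℓ : Level) : Set (lsuc ℓ) where
  infixr 5 _⇒_
  infix 4 _≼_
  field
    Carrier        : Set ℓ
    _≼_            : Carrier → Carrier → Set ℓ
    isPartialOrder : IsPartialOrder _≡_ _≼_
    ⋀              : {I : Set ℓ} → (I → Carrier) → Carrier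
    ⋀-lower        : {I : Set ℓ} (f : I → Carrier) (i : I) → ⋀ f ≼ f i
    ⋀-greatest     : {I : Set ℓ} (f : I → Carrier) (x : Carrier) →
                     ((i : I) → x ≼ f i) → x ≼ ⋀ f
    _⇒_            : Carrier → Carrier → Carrier
    ⇒-mono         : ∀ {a a' b b'} → a' ≼ a → b ≼ b' → (a ⇒ b) ≼ (a' ⇒ b')
    ⇒-⋀            : (a : Carrier) {I : Set ℓ} (f : I → Carrier) →
                     (a ⇒ ⋀ f) ≡ ⋀ (λ i → a ⇒ f i)

  K : Carrier
  K = ⋀ {Carrier × Carrier} (λ { (a , b) → a ⇒ b ⇒ a })

  S : Carrier
  S = ⋀ {Carrier × Carrier × Carrier}
        (λ { (a , b , c) → (a ⇒ b ⇒ c) ⇒ (a ⇒ b) ⇒ a ⇒ c })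

record IsSeparator {ℓ} (𝒜 : ImplicativeStructure ℓ)
                   (Sep : ImplicativeStructure.Carrier 𝒜 → Set ℓ) : Set ℓ where
  open ImplicativeStructure 𝒜
  field
    upward : ∀ {a b} → a ≼ b → Sep a → Sep b
    K∈     : Sep K
    S∈     : Sep S
    mp     : ∀ {a b} → Sep (a ⇒ b) → Sep a → Sep b

record ImplicativeAlgebra (ℓ : Level) : Set (lsuc ℓ) where
  field
    structure   : ImplicativeStructure ℓ
    Sep         : ImplicativeStructure.Carrier structure → Set ℓ
    isSeparator : IsSeparator structure Sep
  open ImplicativeStructure structure public

module _ {ℓ} (𝒜 : ImplicativeAlgebra ℓ) where
  open ImplicativeAlgebra 𝒜

  UniformPower : (I : Set ℓ) → (I → Carrier) → Set ℓ
  UniformPower I a = Σ Carrier (λ s → Sep s × ((i : I) → s ≼ a i))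

  Entails : (I : Set ℓ) → (I → Carrier) → (I → Carrier) → Set ℓ
  Entails I a b = UniformPower I (λ i → a i ⇒ b i)

-- The
-- poset reflection of P I is represented as the setoid (P I, ≈) with
-- x ≈ y iff x ≤ y and y ≤ x (Agda has no quotient types); all equations
-- in the quotient are stated up to ≈.

IsPullback : ∀ {ℓ} {I I₁ I₂ J : Set ℓ}
             (f₁ : I → I₁) (f₂ : I → I₂) (g₁ : I₁ → J) (g₂ : I₂ → J) → Set ℓ
IsPullback {I = I} f₁ f₂ g₁ g₂ =
  ((i : I) → g₁ (f₁ i) ≡ g₂ (f₂ i)) ×
  (∀ i₁ i₂ → g₁ i₁ ≡ g₂ i₂ →
     Σ I (λ i → f₁ i ≡ i₁ × f₂ i ≡ i₂ ×
                ((i' : I) → f₁ i' ≡ i₁ → f₂ i' ≡ i₂ → i' ≡ i)))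

module _ {ℓ p r : Level}
         (P : Set ℓ → Set p)
         (_≤_ : {I : Set ℓ} → P I → P I → Set r)
         (reindex : {I J : Set ℓ} → (I → J) → P J → P I) where

  _≈_ : {I : Set ℓ} → P I → P I → Set r
  x ≈ y = (x ≤ y) × (y ≤ x)

  record IsHAFunctor : Set (lsuc ℓ ⊔ p ⊔ r) where
    field
      _∨ₚ_ _∧ₚ_ _⇨ₚ_ : {I : Set ℓ} → P I → P I → P I
      ⊤ₚ ⊥ₚ         : {I : Set ℓ} → P I
      isHeytingAlgebra : (I : Set ℓ) →
        IsHeytingAlgebra (_≈_ {I}) (_≤_ {I}) _∨ₚ_ _∧ₚ_ _⇨ₚ_ ⊤ₚ ⊥ₚ
      -- P f is a map of posets (hence well defined on the quotient)
      reindex-mono : {I J : Set ℓ} (f : I → J) {x y : P J} →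
                     x ≤ y → reindex f x ≤ reindex f y
      reindex-∨ : {I J : Set ℓ} (f : I → J) (x y : P J) →
                  reindex f (x ∨ₚ y) ≈ (reindex f x ∨ₚ reindex f y)
      reindex-∧ : {I J : Set ℓ} (f : I → J) (x y : P J) →
                  reindex f (x ∧ₚ y) ≈ (reindex f x ∧ₚ reindex f y)
      reindex-⇨ : {I J : Set ℓ} (f : I → J) (x y : P J) →
                  reindex f (x ⇨ₚ y) ≈ (reindex f x ⇨ₚ reindex f y)
      reindex-⊤ : {I J : Set ℓ} (f : I → J) → reindex f (⊤ₚ {J}) ≈ ⊤ₚ {I}
      reindex-⊥ : {I J : Set ℓ} (f : I → J) → reindex f (⊥ₚ {J}) ≈ ⊥ₚ {I}
      reindex-id   : {I : Set ℓ} (x : P I) → reindex id x ≈ x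
      reindex-comp : {I J K : Set ℓ} (f : I → J) (g : J → K) (x : P K) →
                     reindex (g ∘ f) x ≈ reindex f (reindex g x)

  record IsSetTripos : Set (lsuc ℓ ⊔ p ⊔ r) where
    field
      isHAFunctor : IsHAFunctor
      ∃ₚ : {I J : Set ℓ} → (I → J) → P I → P J
      ∀ₚ : {I J : Set ℓ} → (I → J) → P I → P J
      ∃-adjoint : {I J : Set ℓ} (f : I → J) (x : P I) (y : P J) →
                  (∃ₚ f x ≤ y → x ≤ reindex f y) × (x ≤ reindex f y → ∃ₚ f x ≤ y)
      ∀-adjoint : {I J : Set ℓ} (f : I → J) (y : P J) (x : P I) →
                  (reindex f y ≤ x → y ≤ ∀ₚ f x) × (y ≤ ∀ₚ f x → reindex f y ≤ x)
      beck-chevalley-∃ :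
        {I I₁ I₂ J : Set ℓ} (f₁ : I → I₁) (f₂ : I → I₂) (g₁ : I₁ → J) (g₂ : I₂ → J) →
        IsPullback f₁ f₂ g₁ g₂ →
        (x : P I₂) → ∃ₚ f₁ (reindex f₂ x) ≈ reindex g₁ (∃ₚ g₂ x)
      beck-chevalley-∀ :
        {I I₁ I₂ J : Set ℓ} (f₁ : I → I₁) (f₂ : I → I₂) (g₁ : I₁ → J) (g₂ : I₂ → J) →
        IsPullback f₁ f₂ g₁ g₂ →
        (x : P I₂) → ∀ₚ f₁ (reindex f₂ x) ≈ reindex g₁ (∀ₚ g₂ x)
      Prop    : Set ℓ
      Tr      : P Prop
      generic : (I : Set ℓ) (φ : P I) → Σ (I → Prop) (λ f → reindex f Tr ≈ φ)

module Submission where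

-- Application a · b = ⋀{c | a ≼ b ⇒ c}
--    satisfies the elimination rule of ⇒, S is closed under it, and
--    bracket abstraction over S, K and I = S·K·K turns every λ-term with
--    constants from S into an element of S with the expected "type".
--    Each entailment below is witnessed by such a closed λ-term.
--  * Heyting structure.  ⇒ is computed pointwise, ∧, ∨, ⊥ are the
--    impredicative (second-order) encodings, ⊤ = K.  Reindexing a ↦ a ∘ f
--    commutes with all of them on the nose, so functoriality is trivial.
--  * Quantifiers.  ∀ f a y is the meet of a over the fibre f⁻¹(y) and
--    ∃ f a y = ⋀_c (∀ f (a ⇒ c) y ⇒ c).  Over a pullback the relevant
--    fibres map onto each other, which gives Beck–Chevalley for ∀
--    pointwise, and for ∃ as a consequence.  The generic predicate is the
--    identity family on A.

open import Defs
open import Level using (Level)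
open import Function using (_∘_; id)
open import Data.Product using (_×_; _,_; Σ; proj₁; proj₂)
open import Data.Nat using (ℕ; suc)
open import Data.Fin using (Fin; zero; suc)
open import Relation.Binary.PropositionalEquality using (_≡_; refl; subst; sym; trans; cong)
open import Relation.Binary.Structures using (IsPartialOrder)
open import Relation.Binary.Lattice.Structures using (IsHeytingAlgebra)

module ImplicativeTripos {ℓ} (𝒜 : ImplicativeAlgebra ℓ) where
  open ImplicativeAlgebra 𝒜
  open IsSeparator isSeparator
  open IsPartialOrder isPartialOrder using () renaming (refl to ≼-refl; trans to ≼-trans)

  C : Set ℓ
  C = Carrier

  ⋀-along : {I J : Set ℓ} (u : I → C) (v : J → C) (h : I → J) →
            ((i : I) → v (h i) ≡ u i) → ⋀ v ≼ ⋀ u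
  ⋀-along u v h e = ⋀-greatest u (⋀ v) (λ i → subst (⋀ v ≼_) (e i) (⋀-lower v (h i)))

  -- Since ⇒ commutes with meets in its codomain, a ≼ b ⇒ ⋀ f is the same
  -- as a ≼ b ⇒ f i for all i.
  ≼⇒⋀-intro : ∀ {a b} {I : Set ℓ} (f : I → C) → ((i : I) → a ≼ b ⇒ f i) → a ≼ b ⇒ ⋀ f
  ≼⇒⋀-intro {a} {b} f h = subst (a ≼_) (sym (⇒-⋀ b f)) (⋀-greatest _ a h)

  ≼⇒⋀-elim : ∀ {a b} {I : Set ℓ} (f : I → C) → a ≼ b ⇒ ⋀ f → (i : I) → a ≼ b ⇒ f i
  ≼⇒⋀-elim f h i = ≼-trans h (⇒-mono ≼-refl (⋀-lower f i))

  infixl 7 _·_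
  _·_ : C → C → C
  a · b = ⋀ {Σ C (λ c → a ≼ b ⇒ c)} proj₁

  ·-adjoint : ∀ {a b} → a ≼ b ⇒ (a · b)
  ·-adjoint = ≼⇒⋀-intro proj₁ proj₂

  app : ∀ {t u X Y} → t ≼ X ⇒ Y → u ≼ X → t · u ≼ Y
  app {Y = Y} h k = ⋀-lower proj₁ (Y , ≼-trans h (⇒-mono k ≼-refl))

  Sep-· : ∀ {a b} → Sep a → Sep b → Sep (a · b)
  Sep-· sa sb = mp (upward ·-adjoint sa) sb

  K-type : ∀ {X Y} → K ≼ X ⇒ Y ⇒ X
  K-type {X} {Y} = ⋀-lower _ (X , Y)

  S-type : ∀ {X Y Z} → S ≼ (X ⇒ Y ⇒ Z) ⇒ (X ⇒ Y) ⇒ X ⇒ Z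
  S-type {X} {Y} {Z} = ⋀-lower _ (X , Y , Z)

  I : C
  I = S · K · K

  Sep-I : Sep I
  Sep-I = Sep-· (Sep-· S∈ K∈) K∈

  I-type : ∀ {X} → I ≼ X ⇒ X
  I-type {X} = app (app (S-type {X} {X ⇒ X} {X}) K-type) K-type

  infixl 7 _$_
  data Tm (n : ℕ) : Set ℓ where
    var : Fin n → Tm n
    cst : (c : C) → Sep c → Tm n
    _$_ : Tm n → Tm n → Tm n

  extend : ∀ {n} → C → (Fin n → C) → Fin (suc n) → C
  extend a ρ zero    = a
  extend a ρ (suc k) = ρ k

  eval : ∀ {n} → (Fin n → C) → Tm n → C
  eval ρ (var k)   = ρ k
  eval ρ (cst c _) = c
  eval ρ (M $ N)   = eval ρ M · eval ρ N

  lam : ∀ {n} → Tm (suc n) → Tm n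
  lam (var zero)    = cst I Sep-I
  lam (var (suc k)) = cst K K∈ $ var k
  lam (cst c s)     = cst K K∈ $ cst c s
  lam (M $ N)       = cst S S∈ $ lam M $ lam N

  lam-β : ∀ {n} (ρ : Fin n → C) a M → eval ρ (lam M) ≼ a ⇒ eval (extend a ρ) M
  lam-β ρ a (var zero)    = I-type
  lam-β ρ a (var (suc k)) = app K-type ≼-refl
  lam-β ρ a (cst c _)     = app K-type ≼-refl
  lam-β ρ a (M $ N)       =
    app (app S-type (≼-trans (lam-β ρ a M) (⇒-mono ≼-refl ·-adjoint))) (lam-β ρ a N)

  lam-intro : ∀ {n} (ρ : Fin n → C) {a b} M → eval (extend a ρ) M ≼ b → eval ρ (lam M) ≼ a ⇒ b
  lam-intro ρ M h = ≼-trans (lam-β ρ _ M) (⇒-mono ≼-refl h)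

  ∅ : Fin 0 → C
  ∅ ()

  ⟦_⟧ : Tm 0 → C
  ⟦ M ⟧ = eval ∅ M

  Sep-eval : ∀ {n} (ρ : Fin n → C) → ((k : Fin n) → Sep (ρ k)) → ∀ M → Sep (eval ρ M)
  Sep-eval ρ h (var k)   = h k
  Sep-eval ρ h (cst c s) = s
  Sep-eval ρ h (M $ N)   = Sep-· (Sep-eval ρ h M) (Sep-eval ρ h N)

  Sep-⟦⟧ : ∀ M → Sep ⟦ M ⟧
  Sep-⟦⟧ = Sep-eval ∅ (λ ())

  v0 : ∀ {n} → Tm (suc n)
  v0 = var zero

  v1 : ∀ {n} → Tm (suc (suc n))
  v1 = var (suc zero)

  v2 : ∀ {n} → Tm (suc (suc (suc n)))
  v2 = var (suc (suc zero))

  infix 4 _⊢_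
  _⊢_ : {J : Set ℓ} → (J → C) → (J → C) → Set ℓ
  _⊢_ {J} = Entails 𝒜 J

  by-term : ∀ {J} {a b : J → C} (M : Tm 0) → ((j : J) → ⟦ M ⟧ ≼ a j ⇒ b j) → a ⊢ b
  by-term M h = ⟦ M ⟧ , Sep-⟦⟧ M , h

  ⊢-≼ : ∀ {J} {a b : J → C} → ((j : J) → a j ≼ b j) → a ⊢ b
  ⊢-≼ h = I , Sep-I , (λ j → ≼-trans I-type (⇒-mono ≼-refl (h j)))

  ⊢-refl : ∀ {J} {a : J → C} → a ⊢ a
  ⊢-refl = ⊢-≼ (λ _ → ≼-refl)

  ⊢-trans : ∀ {J} {a b c : J → C} → a ⊢ b → b ⊢ c → a ⊢ c
  ⊢-trans (s , s∈ , hs) (t , t∈ , ht) =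
    by-term (lam M) (λ j → lam-intro ∅ M (app (ht j) (app (hs j) ≼-refl)))
    where M : Tm 1
          M = cst t t∈ $ (cst s s∈ $ v0)

  _∧ᵃ_ _∨ᵃ_ : C → C → C
  a ∧ᵃ b = ⋀ {C} (λ c → (a ⇒ b ⇒ c) ⇒ c)
  a ∨ᵃ b = ⋀ {C} (λ c → (a ⇒ c) ⇒ (b ⇒ c) ⇒ c)

  ⊥ᵃ : C
  ⊥ᵃ = ⋀ {C} id

  _∧ₚ_ _∨ₚ_ _⇒ₚ_ : {J : Set ℓ} → (J → C) → (J → C) → J → C
  (a ∧ₚ b) j = a j ∧ᵃ b j
  (a ∨ₚ b) j = a j ∨ᵃ b j
  (a ⇒ₚ b) j = a j ⇒ b j

  ⊤ₚ ⊥ₚ : {J : Set ℓ} → J → C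
  ⊤ₚ _ = K
  ⊥ₚ _ = ⊥ᵃ

  ∧-fst : ∀ {J} (a b : J → C) → (a ∧ₚ b) ⊢ a
  ∧-fst a b = by-term (lam M) (λ j → lam-intro ∅ M (app (⋀-lower _ (a j)) K-type))
    where M : Tm 1
          M = v0 $ cst K K∈

  ∧-snd : ∀ {J} (a b : J → C) → (a ∧ₚ b) ⊢ b
  ∧-snd a b = by-term (lam M) (λ j → lam-intro ∅ M (app (⋀-lower _ (b j)) (app K-type I-type)))
    where M : Tm 1
          M = v0 $ cst (K · I) (Sep-· K∈ Sep-I)

  ∧-greatest : ∀ {J} {z a b : J → C} → z ⊢ a → z ⊢ b → z ⊢ (a ∧ₚ b)
  ∧-greatest {z = z} (s , s∈ , hs) (t , t∈ , ht) =
    by-term (lam (lam M)) (λ j → lam-intro ∅ (lam M) (⋀-greatest _ _ (λ c →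
      lam-intro (extend (z j) ∅) M (app (app ≼-refl (app (hs j) ≼-refl)) (app (ht j) ≼-refl)))))
    where M : Tm 2
          M = v0 $ (cst s s∈ $ v1) $ (cst t t∈ $ v1)

  ∨-inl : ∀ {J} (a b : J → C) → a ⊢ (a ∨ₚ b)
  ∨-inl a b = by-term (lam (lam (lam M))) (λ j → lam-intro ∅ (lam (lam M)) (⋀-greatest _ _ (λ c →
    lam-intro (extend (a j) ∅) (lam M)
      (lam-intro (extend (a j ⇒ c) (extend (a j) ∅)) M (app ≼-refl ≼-refl)))))
    where M : Tm 3
          M = v1 $ v2

  ∨-inr : ∀ {J} (a b : J → C) → b ⊢ (a ∨ₚ b)
  ∨-inr a b = by-term (lam (lam (lam M))) (λ j → lam-intro ∅ (lam (lam M)) (⋀-greatest _ _ (λ c →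
    lam-intro (extend (b j) ∅) (lam M)
      (lam-intro (extend (a j ⇒ c) (extend (b j) ∅)) M (app ≼-refl ≼-refl)))))
    where M : Tm 3
          M = v0 $ v2

  ∨-least : ∀ {J} {a b z : J → C} → a ⊢ z → b ⊢ z → (a ∨ₚ b) ⊢ z
  ∨-least {z = z} (s , s∈ , hs) (t , t∈ , ht) =
    by-term (lam M) (λ j → lam-intro ∅ M (app (app (⋀-lower _ (z j)) (hs j)) (ht j)))
    where M : Tm 1
          M = v0 $ cst s s∈ $ cst t t∈

  ⊤-maximum : ∀ {J} (a : J → C) → a ⊢ ⊤ₚ
  ⊤-maximum a = K · K , Sep-· K∈ K∈ , (λ j → app K-type ≼-refl)

  ⊥-minimum : ∀ {J} (a : J → C) → ⊥ₚ ⊢ a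
  ⊥-minimum a = ⊢-≼ (λ j → ⋀-lower id (a j))

  curry : ∀ {J} {w a b : J → C} → (w ∧ₚ a) ⊢ b → w ⊢ (a ⇒ₚ b)
  curry {w = w} {a} (s , s∈ , hs) =
    by-term (lam (lam M)) (λ j → lam-intro ∅ (lam M) (lam-intro (extend (w j) ∅) M (app (hs j)
      (⋀-greatest _ _ (λ c → lam-intro (extend (a j) (extend (w j) ∅)) pair (app (app ≼-refl ≼-refl) ≼-refl))))))
    where pair : Tm 3
          pair = v0 $ v2 $ v1
          M : Tm 2
          M = cst s s∈ $ lam pair

  uncurry : ∀ {J} {w a b : J → C} → w ⊢ (a ⇒ₚ b) → (w ∧ₚ a) ⊢ b
  uncurry {b = b} (s , s∈ , hs) =
    by-term (lam M) (λ j → lam-intro ∅ M (app (⋀-lower _ (b j)) (hs j)))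
    where M : Tm 1
          M = v0 $ cst s s∈

  _≈ₚ_ : {J : Set ℓ} → (J → C) → (J → C) → Set ℓ
  _≈ₚ_ = _≈_ (λ X → X → C) _⊢_ (λ f a → a ∘ f)

  isHeytingAlgebra : (J : Set ℓ) → IsHeytingAlgebra (_≈ₚ_ {J}) _⊢_ _∨ₚ_ _∧ₚ_ _⇒ₚ_ ⊤ₚ ⊥ₚ
  isHeytingAlgebra J = record
    { isBoundedLattice = record
      { isLattice = record
        { isPartialOrder = record
          { isPreorder = record
            { isEquivalence = record
              { refl  = ⊢-refl , ⊢-refl
              ; sym   = λ { (p , q) → q , p }
              ; trans = λ { (p , q) (p' , q') → ⊢-trans p p' , ⊢-trans q' q } }
            ; reflexive = proj₁
            ; trans     = ⊢-trans }
          ; antisym = _,_ }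
        ; supremum = λ a b → ∨-inl a b , ∨-inr a b , λ _ → ∨-least
        ; infimum  = λ a b → ∧-fst a b , ∧-snd a b , λ _ → ∧-greatest }
      ; maximum = ⊤-maximum
      ; minimum = ⊥-minimum }
    ; exponential = λ _ _ _ → curry , uncurry }

  reindex-mono : {X Y : Set ℓ} (f : X → Y) {a b : Y → C} → a ⊢ b → (a ∘ f) ⊢ (b ∘ f)
  reindex-mono f (s , s∈ , hs) = s , s∈ , (λ i → hs (f i))

  isHAFunctor : IsHAFunctor (λ X → X → C) _⊢_ (λ f a → a ∘ f)
  isHAFunctor = record
    { _∨ₚ_ = _∨ₚ_
    ; _∧ₚ_ = _∧ₚ_
    ; _⇨ₚ_ = _⇒ₚ_
    ; ⊤ₚ = ⊤ₚ
    ; ⊥ₚ = ⊥ₚ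
    ; isHeytingAlgebra = isHeytingAlgebra
    ; reindex-mono = reindex-mono
    ; reindex-∨    = λ _ _ _ → ⊢-refl , ⊢-refl
    ; reindex-∧    = λ _ _ _ → ⊢-refl , ⊢-refl
    ; reindex-⇨    = λ _ _ _ → ⊢-refl , ⊢-refl
    ; reindex-⊤    = λ _ → ⊢-refl , ⊢-refl
    ; reindex-⊥    = λ _ → ⊢-refl , ⊢-refl
    ; reindex-id   = λ _ → ⊢-refl , ⊢-refl
    ; reindex-comp = λ _ _ _ → ⊢-refl , ⊢-refl }

  Fibre : {X Y : Set ℓ} → (X → Y) → Y → Set ℓ
  Fibre {X} f y = Σ X (λ x → f x ≡ y)

  ∀ₐ : {X Y : Set ℓ} → (X → Y) → (X → C) → Y → C
  ∀ₐ f a y = ⋀ {Fibre f y} (λ k → a (proj₁ k))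

  ∃ₐ : {X Y : Set ℓ} → (X → Y) → (X → C) → Y → C
  ∃ₐ f a y = ⋀ {C} (λ c → ∀ₐ f (λ x → a x ⇒ c) y ⇒ c)

  ∃-adjoint-to : {X Y : Set ℓ} (f : X → Y) (a : X → C) (b : Y → C) → ∃ₐ f a ⊢ b → a ⊢ (b ∘ f)
  ∃-adjoint-to f a b (s , s∈ , hs) = by-term (lam M) (λ i →
    lam-intro ∅ M (app (hs (f i)) (⋀-greatest _ _ (λ c →
      lam-intro (extend (a i) ∅) (v0 $ v1) (app (⋀-lower _ (i , refl)) ≼-refl)))))
    where M : Tm 1
          M = cst s s∈ $ lam (v0 $ v1)

  ∃-adjoint-from : {X Y : Set ℓ} (f : X → Y) (a : X → C) (b : Y → C) → a ⊢ (b ∘ f) → ∃ₐ f a ⊢ b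
  ∃-adjoint-from f a b (s , s∈ , hs) = by-term (lam M) (λ y →
    lam-intro ∅ M (app (⋀-lower _ (b y)) (⋀-greatest _ _ (λ { (i , refl) → hs i }))))
    where M : Tm 1
          M = v0 $ cst s s∈

  -- P f ⊣ ∀ f: the same witness works in both directions, because
  -- ⇒ commutes with meets.
  ∀-adjoint-to : {X Y : Set ℓ} (f : X → Y) (b : Y → C) (a : X → C) → (b ∘ f) ⊢ a → b ⊢ ∀ₐ f a
  ∀-adjoint-to f b a (s , s∈ , hs) = s , s∈ , (λ y → ≼⇒⋀-intro _ (λ { (i , refl) → hs i }))

  ∀-adjoint-from : {X Y : Set ℓ} (f : X → Y) (b : Y → C) (a : X → C) → b ⊢ ∀ₐ f a → (b ∘ f) ⊢ a
  ∀-adjoint-from f b a (s , s∈ , hs) = s , s∈ , (λ i → ≼⇒⋀-elim _ (hs (f i)) (i , refl))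

  -- For a pullback g₁ ∘ f₁ = g₂ ∘ f₂ and i₁ ∈ I₁, the map
  -- f₂ sends the fibre f₁⁻¹(i₁) into g₂⁻¹(g₁ i₁), and every point of the
  -- latter is hit; so both fibres index the same family of values.
  module BeckChevalley {X X₁ X₂ Z : Set ℓ}
           (f₁ : X → X₁) (f₂ : X → X₂) (g₁ : X₁ → Z) (g₂ : X₂ → Z)
           (pb : IsPullback f₁ f₂ g₁ g₂) where

    fibre-map : ∀ i₁ → Fibre f₁ i₁ → Fibre g₂ (g₁ i₁)
    fibre-map i₁ (i , e) = f₂ i , trans (sym (proj₁ pb i)) (cong g₁ e)

    fibre-lift : ∀ i₁ → Fibre g₂ (g₁ i₁) → Fibre f₁ i₁
    fibre-lift i₁ (i₂ , e) with proj₂ pb i₁ i₂ (sym e)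
    ... | i , e₁ , _ = i , e₁

    fibre-lift-section : ∀ i₁ (k : Fibre g₂ (g₁ i₁)) → f₂ (proj₁ (fibre-lift i₁ k)) ≡ proj₁ k
    fibre-lift-section i₁ (i₂ , e) with proj₂ pb i₁ i₂ (sym e)
    ... | _ , _ , e₂ , _ = e₂

    ∀-BC-≼ : (a : X₂ → C) (i₁ : X₁) → ∀ₐ f₁ (a ∘ f₂) i₁ ≼ ∀ₐ g₂ a (g₁ i₁)
    ∀-BC-≼ a i₁ = ⋀-along _ _ (fibre-lift i₁) (λ k → cong a (fibre-lift-section i₁ k))

    ∀-BC-≽ : (a : X₂ → C) (i₁ : X₁) → ∀ₐ g₂ a (g₁ i₁) ≼ ∀ₐ f₁ (a ∘ f₂) i₁
    ∀-BC-≽ a i₁ = ⋀-along _ _ (fibre-map i₁) (λ _ → refl)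

    -- ∃ is built from ∀ contravariantly, so its Beck–Chevalley law follows.
    ∃-BC-≼ : (a : X₂ → C) (i₁ : X₁) → ∃ₐ f₁ (a ∘ f₂) i₁ ≼ ∃ₐ g₂ a (g₁ i₁)
    ∃-BC-≼ a i₁ = ⋀-greatest _ _ (λ c →
      ≼-trans (⋀-lower _ c) (⇒-mono (∀-BC-≽ (λ x → a x ⇒ c) i₁) ≼-refl))

    ∃-BC-≽ : (a : X₂ → C) (i₁ : X₁) → ∃ₐ g₂ a (g₁ i₁) ≼ ∃ₐ f₁ (a ∘ f₂) i₁
    ∃-BC-≽ a i₁ = ⋀-greatest _ _ (λ c →
      ≼-trans (⋀-lower _ c) (⇒-mono (∀-BC-≼ (λ x → a x ⇒ c) i₁) ≼-refl))

    ∃-BC : (a : X₂ → C) → ∃ₐ f₁ (a ∘ f₂) ≈ₚ (∃ₐ g₂ a ∘ g₁)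
    ∃-BC a = ⊢-≼ (∃-BC-≼ a) , ⊢-≼ (∃-BC-≽ a)

    ∀-BC : (a : X₂ → C) → ∀ₐ f₁ (a ∘ f₂) ≈ₚ (∀ₐ g₂ a ∘ g₁)
    ∀-BC a = ⊢-≼ (∀-BC-≼ a) , ⊢-≼ (∀-BC-≽ a)

  isSetTripos : IsSetTripos (λ X → X → C) _⊢_ (λ f a → a ∘ f)
  isSetTripos = record
    { isHAFunctor = isHAFunctor
    ; ∃ₚ = ∃ₐ
    ; ∀ₚ = ∀ₐ
    ; ∃-adjoint = λ f a b → ∃-adjoint-to f a b , ∃-adjoint-from f a b
    ; ∀-adjoint = λ f b a → ∀-adjoint-to f b a , ∀-adjoint-from f b a
    ; beck-chevalley-∃ = λ f₁ f₂ g₁ g₂ pb → BeckChevalley.∃-BC f₁ f₂ g₁ g₂ pb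
    ; beck-chevalley-∀ = λ f₁ f₂ g₁ g₂ pb → BeckChevalley.∀-BC f₁ f₂ g₁ g₂ pb
    ; Prop = C
    ; Tr = id
    ; generic = λ _ φ → φ , ⊢-refl , ⊢-refl }

theorem4p11 : {ℓ : Level} (𝒜 : ImplicativeAlgebra ℓ) →
    IsHAFunctor (λ I → I → ImplicativeAlgebra.Carrier 𝒜)
                (λ {I} → Entails 𝒜 I)
                (λ f a → a ∘ f)
    × IsSetTripos (λ I → I → ImplicativeAlgebra.Carrier 𝒜)
                  (λ {I} → Entails 𝒜 I)
                  (λ f a → a ∘ f)
theorem4p11 𝒜 = isHAFunctor , isSetTripos
  where open ImplicativeTripos 𝒜
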